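{- Let $G$ be a directed graph, let $q\ge k$ be positive integers, let $U\subseteq V(G)$ be $(q,k)$-unbreakable in $G$, and let $F\subseteq E(G)$ with $|F|\le k$. Then $G-F$ has a strongly connected component $C$ with $|C\cap U|\ge|U|-2q$.
   Context: $V=V(G)$. For $S\subseteq V$, $\delta^+_G(S)$ ($\delta^-_G(S)$) is the set of edges leaving (entering) $S$. For positive integers $q\ge k$, $U\subseteq V$ is $(q,k)$-unbreakable in $G$ if for every cut $(S,V-S)$ with $|\delta^+_G(S)|\le k$ or $|\delta^-_G(S)|\le k$, either $|S\cap U|\le q$ or $|U-S|\le q$. -}

module Defs where

open import Data.Nat using (ℕ; _≤_)
open import Data.Bool using (Bool; _∧_; not)
open import Data.Fin using (Fin)
open import Data.Fin.Subset using (Subset; _∈_; _∉_; _∩_; _─_; ∣_∣)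
open import Data.Vec using (tabulate; lookup)
open import Data.Product using (_×_; ∃; proj₁; proj₂)
open import Data.Sum using (_⊎_)

-- A finite directed (multi)graph on vertex set Fin n with m edges;
-- edge e goes from tail e = proj₁ (E e) to head e = proj₂ (E e).
Digraph : ℕ → ℕ → Set
Digraph n m = Fin m → Fin n × Fin n

module _ {n m : ℕ} (E : Digraph n m) where

  tail head : Fin m → Fin n
  tail e = proj₁ (E e)
  head e = proj₂ (E e)

  δ⁺ : Subset n → Subset m
  δ⁺ S = tabulate λ e → lookup S (tail e) ∧ not (lookup S (head e))

  δ⁻ : Subset n → Subset m
  δ⁻ S = tabulate λ e → not (lookup S (tail e)) ∧ lookup S (head e)

  Unbreakable : ℕ → ℕ → Subset n → Set
  Unbreakable q k U = ∀ (S : Subset n) →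
    (∣ δ⁺ S ∣ ≤ k ⊎ ∣ δ⁻ S ∣ ≤ k) →
    (∣ S ∩ U ∣ ≤ q ⊎ ∣ U ─ S ∣ ≤ q)

  data Reach (F : Subset m) : Fin n → Fin n → Set where
    here : ∀ {u} → Reach F u u
    step : ∀ {v} (e : Fin m) → e ∉ F → Reach F (head e) v → Reach F (tail e) v

  IsSCC : Subset m → Subset n → Set
  IsSCC F C =
    (∃ λ v → v ∈ C) ×
    (∀ u v → u ∈ C → v ∈ C → Reach F u v) ×
    (∀ u v → u ∈ C → Reach F u v → Reach F v u → v ∈ C)

{-# OPTIONS --safe #-}
module Submission where

-- Call S ⊆ V closed if no edge of G − F leaves it.  Then δ⁺(S) ⊆ F, so by
-- unbreakability every closed S contains at most q vertices of U or misses
-- at most q of them.  Starting from S = V, repeatedly delete from the closed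
-- set S a strongly connected component C of G − F that is a source within S;
-- S − C is closed again.  While S − C misses at most q vertices of U we
-- continue with it; once it does not, S − C contains at most q vertices of U
-- and U − S at most q, so C contains all but 2q vertices of U.

open import Defs
open import Data.Bool using (Bool; true; _∧_; not)
open import Data.Bool.Properties using (∧-conicalˡ; ∧-conicalʳ; not-¬; T-≡)
open import Data.Fin using (Fin; zero; suc)
open import Data.Fin.Properties using (any?)
open import Data.Fin.Subset
  using (Subset; _∈_; _∉_; _∩_; _∪_; _─_; ⁅_⁆; ∣_∣; _⊆_; _⊂_; _⊃_; ⊤; inside; outside)
open import Data.Fin.Subset.Properties
open import Data.Fin.Subset.Induction using (⊂-wellFounded; ⊃-wellFounded; Acc; acc)
open import Data.Nat using (ℕ; _≤_; _+_; _*_; z≤n; s≤s)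
open import Data.Nat.Properties
  using (≤-trans; ≤-reflexive; +-suc; +-monoʳ-≤; +-mono-≤; m≤m+n; module ≤-Reasoning)
open import Data.Product using (∃; _×_; _,_; proj₁; proj₂)
open import Data.Sum using (_⊎_; inj₁; inj₂)
open import Data.Vec using (_∷_; []; tabulate; lookup; there)
open import Data.Vec.Properties using (lookup∘tabulate; []=⇒lookup; lookup⇒[]=)
open import Function using (_∘_; _on_)
open import Function.Bundles using (Equivalence)
import Relation.Binary.Construct.On as On
open import Relation.Nullary using (Dec; yes; no)
open import Relation.Nullary.Decidable
  using (isYes; toWitness; fromWitness; map′; decidable-stable; _×-dec_; ¬?)
open import Relation.Binary.PropositionalEquality using (_≡_; sym; trans; cong; subst)

private
  variable
    n : ℕ

∈-tabulate⁺ : ∀ {f : Fin n → Bool} {x} → f x ≡ true → x ∈ tabulate f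
∈-tabulate⁺ {f = f} {x} fx≡true = lookup⇒[]= x (tabulate f) (trans (lookup∘tabulate f x) fx≡true)

∈-tabulate⁻ : ∀ {f : Fin n → Bool} {x} → x ∈ tabulate f → f x ≡ true
∈-tabulate⁻ {f = f} {x} x∈ = trans (sym (lookup∘tabulate f x)) ([]=⇒lookup x∈)

module _ {P : Fin n → Set} (P? : ∀ x → Dec (P x)) where

  fromDec : Subset n
  fromDec = tabulate (isYes ∘ P?)

  ∈-fromDec⁺ : ∀ {x} → P x → x ∈ fromDec
  ∈-fromDec⁺ p = ∈-tabulate⁺ (Equivalence.to T-≡ (fromWitness p))

  ∈-fromDec⁻ : ∀ {x} → x ∈ fromDec → P x
  ∈-fromDec⁻ x∈ = toWitness (Equivalence.from T-≡ (∈-tabulate⁻ x∈))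

x∈p─q⇒x∉q : ∀ {p q : Subset n} {x} → x ∈ p ─ q → x ∉ q
x∈p─q⇒x∉q {p = _ ∷ _} {inside  ∷ _} {zero}  ()          _
x∈p─q⇒x∉q {p = _ ∷ _} {outside ∷ _} {zero}  _           ()
x∈p─q⇒x∉q {p = _ ∷ _} {_       ∷ _} {suc x} (there x∈) (there x∈q) = x∈p─q⇒x∉q x∈ x∈q

p⊂p∪⁅x⁆ : ∀ {p : Subset n} {x} → x ∉ p → p ⊂ p ∪ ⁅ x ⁆
p⊂p∪⁅x⁆ {p = p} {x} x∉p = p⊆p∪q ⁅ x ⁆ , x , q⊆p∪q p ⁅ x ⁆ (x∈⁅x⁆ x) , x∉p

∣p∪q∣≤∣p∣+∣q∣ : ∀ (p q : Subset n) → ∣ p ∪ q ∣ ≤ ∣ p ∣ + ∣ q ∣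
∣p∪q∣≤∣p∣+∣q∣ []            []            = z≤n
∣p∪q∣≤∣p∣+∣q∣ (inside  ∷ p) (s       ∷ q) =
  s≤s (≤-trans (∣p∪q∣≤∣p∣+∣q∣ p q) (+-monoʳ-≤ ∣ p ∣ (∣p∣≤∣x∷p∣ s q)))
∣p∪q∣≤∣p∣+∣q∣ (outside ∷ p) (inside  ∷ q) =
  ≤-trans (s≤s (∣p∪q∣≤∣p∣+∣q∣ p q)) (≤-reflexive (sym (+-suc ∣ p ∣ ∣ q ∣)))
∣p∪q∣≤∣p∣+∣q∣ (outside ∷ p) (outside ∷ q) = ∣p∪q∣≤∣p∣+∣q∣ p q

∣p∣≤∣q∩p∣+∣r─q∩p∣+∣p─r∣ : ∀ (p q r : Subset n) → ∣ p ∣ ≤ ∣ q ∩ p ∣ + (∣ (r ─ q) ∩ p ∣ + ∣ p ─ r ∣)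
∣p∣≤∣q∩p∣+∣r─q∩p∣+∣p─r∣ p q r = begin
  ∣ p ∣                                     ≤⟨ p⊆q⇒∣p∣≤∣q∣ cover ⟩
  ∣ q ∩ p ∪ ((r ─ q) ∩ p ∪ (p ─ r)) ∣       ≤⟨ ∣p∪q∣≤∣p∣+∣q∣ (q ∩ p) _ ⟩
  ∣ q ∩ p ∣ + ∣ (r ─ q) ∩ p ∪ (p ─ r) ∣     ≤⟨ +-monoʳ-≤ ∣ q ∩ p ∣ (∣p∪q∣≤∣p∣+∣q∣ ((r ─ q) ∩ p) (p ─ r)) ⟩
  ∣ q ∩ p ∣ + (∣ (r ─ q) ∩ p ∣ + ∣ p ─ r ∣) ∎
  where
  open ≤-Reasoning
  cover : p ⊆ q ∩ p ∪ ((r ─ q) ∩ p ∪ (p ─ r))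
  cover {x} x∈p with x ∈? q | x ∈? r
  ... | yes x∈q | _       = x∈p∪q⁺ (inj₁ (x∈p∩q⁺ (x∈q , x∈p)))
  ... | no  x∉q | yes x∈r = x∈p∪q⁺ (inj₂ (x∈p∪q⁺ (inj₁ (x∈p∩q⁺ (x∈p∧x∉q⇒x∈p─q x∈r x∉q , x∈p)))))
  ... | no  _   | no  x∉r = x∈p∪q⁺ (inj₂ (x∈p∪q⁺ (inj₂ (x∈p∧x∉q⇒x∈p─q x∈p x∉r))))

module _ {m : ℕ} (E : Digraph n m) where

  ∈δ⁺⁻ : ∀ {S e} → e ∈ δ⁺ E S → tail E e ∈ S × head E e ∉ S
  ∈δ⁺⁻ {S} {e} e∈δ⁺ = lookup⇒[]= _ S (∧-conicalˡ _ _ leaves) , head∉S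
    where
    leaves : lookup S (tail E e) ∧ not (lookup S (head E e)) ≡ true
    leaves = ∈-tabulate⁻ e∈δ⁺
    head∉S : head E e ∉ S
    head∉S head∈S = not-¬ (sym ([]=⇒lookup head∈S)) (sym (∧-conicalʳ _ _ leaves))

  module _ (F : Subset m) where

    Closed : Subset n → Set
    Closed S = ∀ e → e ∉ F → tail E e ∈ S → head E e ∈ S

    Reach-trans : ∀ {u v w} → Reach E F u v → Reach E F v w → Reach E F u w
    Reach-trans here           r′ = r′
    Reach-trans (step e e∉F r) r′ = step e e∉F (Reach-trans r r′)

    Closed-Reach : ∀ {S u w} → Closed S → u ∈ S → Reach E F u w → w ∈ S
    Closed-Reach closed u∈S here           = u∈S
    Closed-Reach closed u∈S (step e e∉F r) = Closed-Reach closed (closed e e∉F u∈S) r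

    Closed⇒δ⁺⊆F : ∀ {S} → Closed S → δ⁺ E S ⊆ F
    Closed⇒δ⁺⊆F closed {e} e∈δ⁺ = decidable-stable (e ∈? F)
      λ e∉F → let tail∈S , head∉S = ∈δ⁺⁻ e∈δ⁺ in head∉S (closed e e∉F tail∈S)

    closed⊎leaving : ∀ S → Closed S ⊎ ∃ λ e → e ∉ F × tail E e ∈ S × head E e ∉ S
    closed⊎leaving S with any? (λ e → ¬? (e ∈? F) ×-dec (tail E e ∈? S ×-dec ¬? (head E e ∈? S)))
    ... | yes leaving = inj₂ leaving
    ... | no  none    = inj₁ λ e e∉F tail∈S →
      decidable-stable (head E e ∈? S) λ head∉S → none (e , e∉F , tail∈S , head∉S)

    ReachableFrom : Fin n → Subset n → Set
    ReachableFrom u T = ∀ {w} → w ∈ T → Reach E F u w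

    reachable-closure : ∀ u → ∃ λ T → u ∈ T × ReachableFrom u T × Closed T
    reachable-closure u = grow ⁅ u ⁆ (⊃-wellFounded _) (x∈⁅x⁆ u)
      λ w∈⁅u⁆ → subst (Reach E F u) (sym (x∈⁅y⁆⇒x≡y u w∈⁅u⁆)) here
      where
      grow : ∀ S → Acc _⊃_ S → u ∈ S → ReachableFrom u S → ∃ λ T → u ∈ T × ReachableFrom u T × Closed T
      grow S (acc rs) u∈S reachable with closed⊎leaving S
      ... | inj₁ closed = S , u∈S , reachable , closed
      ... | inj₂ (e , e∉F , tail∈S , head∉S) =
        grow (S ∪ ⁅ head E e ⁆) (rs (p⊂p∪⁅x⁆ head∉S)) (p⊆p∪q ⁅ head E e ⁆ u∈S) reachable′
        where
        reachable′ : ReachableFrom u (S ∪ ⁅ head E e ⁆)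
        reachable′ w∈ with x∈p∪q⁻ S ⁅ head E e ⁆ w∈
        ... | inj₁ w∈S    = reachable w∈S
        ... | inj₂ w∈⁅h⁆ rewrite x∈⁅y⁆⇒x≡y _ w∈⁅h⁆ = Reach-trans (reachable tail∈S) (step e e∉F here)

    Reach? : ∀ u w → Dec (Reach E F u w)
    Reach? u w with reachable-closure u
    ... | T , u∈T , reachable , closed = map′ reachable (Closed-Reach closed u∈T) (w ∈? T)

    scc : Fin n → Subset n
    scc v = fromDec (λ w → Reach? v w ×-dec Reach? w v)

    v∈scc-v : ∀ v → v ∈ scc v
    v∈scc-v v = ∈-fromDec⁺ _ (here , here)

    scc-isSCC : ∀ v → IsSCC E F (scc v)
    scc-isSCC v = (v , v∈scc-v v)
                , (λ a b a∈ b∈ → Reach-trans (proj₂ (∈-fromDec⁻ _ a∈)) (proj₁ (∈-fromDec⁻ _ b∈)))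
                , λ a b a∈ a→b b→a → let v→a , a→v = ∈-fromDec⁻ _ a∈ in
                    ∈-fromDec⁺ _ (Reach-trans v→a a→b , Reach-trans b→a a→v)

    ancestors : Fin n → Subset n
    ancestors v = fromDec (λ w → Reach? w v)

    Source : Subset n → Fin n → Set
    Source S s = ∀ {w} → w ∈ S → Reach E F w s → Reach E F s w

    -- A vertex of S whose set of ancestors is ⊂-minimal is a source.
    source-exists : ∀ {S v} → v ∈ S → ∃ λ s → s ∈ S × Source S s
    source-exists {S} {v} = descend v (On.wellFounded ancestors ⊂-wellFounded v)
      where
      descend : ∀ v → Acc (_⊂_ on ancestors) v → v ∈ S → ∃ λ s → s ∈ S × Source S s
      descend v (acc rs) v∈S with any? (λ w → w ∈? S ×-dec (Reach? w v ×-dec ¬? (Reach? v w)))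
      ... | no none = v , v∈S , λ {w} w∈S w→v →
        decidable-stable (Reach? v w) λ v↛w → none (w , w∈S , w→v , v↛w)
      ... | yes (w , w∈S , w→v , v↛w) = descend w (rs fewer) w∈S
        where
        fewer : ancestors w ⊂ ancestors v
        fewer = (λ x∈ → ∈-fromDec⁺ _ (Reach-trans (∈-fromDec⁻ _ x∈) w→v))
              , v , ∈-fromDec⁺ _ here , v↛w ∘ ∈-fromDec⁻ _

    Closed-─scc : ∀ {S s} → Closed S → Source S s → Closed (S ─ scc s)
    Closed-─scc {S} {s} closed source e e∉F tail∈ = x∈p∧x∉q⇒x∈p─q (closed e e∉F tail∈S) head∉scc
      where
      tail∈S : tail E e ∈ S
      tail∈S = p─q⊆p S (scc s) tail∈
      head∉scc : head E e ∉ scc s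
      head∉scc head∈ = x∈p─q⇒x∉q tail∈ (∈-fromDec⁺ _ (source tail∈S tail→s , tail→s))
        where
        tail→s : Reach E F (tail E e) s
        tail→s = step e e∉F (proj₂ (∈-fromDec⁻ _ head∈))

    module _ (q : ℕ) (U : Subset n) where

      scc-covering : ∀ S C → ∣ (S ─ C) ∩ U ∣ ≤ q → ∣ U ─ S ∣ ≤ q → ∣ U ∣ ≤ ∣ C ∩ U ∣ + 2 * q
      scc-covering S C rest-small outside-small = ≤-trans (∣p∣≤∣q∩p∣+∣r─q∩p∣+∣p─r∣ U C S)
        (+-monoʳ-≤ ∣ C ∩ U ∣ (+-mono-≤ rest-small (≤-trans outside-small (m≤m+n q 0))))

      large-scc : Fin n → (∀ T → Closed T → ∣ T ∩ U ∣ ≤ q ⊎ ∣ U ─ T ∣ ≤ q) →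
                  ∃ λ C → IsSCC E F C × ∣ U ∣ ≤ ∣ C ∩ U ∣ + 2 * q
      large-scc v₀ splits = descend ⊤ (⊂-wellFounded ⊤) (λ _ _ _ → ∈⊤) U─⊤-small
        where
        U─⊤-small : ∣ U ─ ⊤ ∣ ≤ q
        U─⊤-small rewrite p─⊤≡⊥ U | ∣⊥∣≡0 n = z≤n

        descend : ∀ S → Acc _⊂_ S → Closed S → ∣ U ─ S ∣ ≤ q → ∃ λ C → IsSCC E F C × ∣ U ∣ ≤ ∣ C ∩ U ∣ + 2 * q
        descend S (acc rs) closed U─S-small with nonempty? S
        ... | no empty = scc v₀ , scc-isSCC v₀ , scc-covering S (scc v₀) rest-small U─S-small
          where
          rest-small : ∣ (S ─ scc v₀) ∩ U ∣ ≤ q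
          rest-small = ≤-trans (∣p∩q∣≤∣p∣ (S ─ scc v₀) U) (≤-trans (∣p─q∣≤∣p∣ S (scc v₀))
            (≤-trans (≤-reflexive (trans (cong ∣_∣ (Empty-unique empty)) (∣⊥∣≡0 n))) z≤n))
        ... | yes (v , v∈S) with source-exists v∈S
        ...   | s , s∈S , source with splits (S ─ scc s) (Closed-─scc closed source)
        ...     | inj₁ rest-small = scc s , scc-isSCC s , scc-covering S (scc s) rest-small U─S-small
        ...     | inj₂ U─rest-small = descend (S ─ scc s)
                  (rs (p∩q≢∅⇒p─q⊂p S (scc s) (s , x∈p∩q⁺ (s∈S , v∈scc-v s))))
                  (Closed-─scc closed source) U─rest-small

claim3p6 : ∀ {n m : ℕ} (E : Digraph n m) (q k : ℕ) →
    1 ≤ n → 1 ≤ k → k ≤ q →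
    (U : Subset n) → Unbreakable E q k U →
    (F : Subset m) → ∣ F ∣ ≤ k →
    ∃ λ (C : Subset n) → IsSCC E F C × ∣ U ∣ ≤ ∣ C ∩ U ∣ + 2 * q
claim3p6 E q k (s≤s z≤n) _ _ U unbreakable F ∣F∣≤k = large-scc E F q U zero λ T closed →
  unbreakable T (inj₁ (≤-trans (p⊆q⇒∣p∣≤∣q∣ (Closed⇒δ⁺⊆F E F closed)) ∣F∣≤k))
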